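{- Let $T$ be a solvable roommate instance and $T^*=E_S(T)$. Then $T^*$ is a valid table, i.e., (a) no agent's list in $T^*$ is empty, and (b) for all agents $z,w$: $w=f_{T^*}(z)$ if and only if $z=\ell_{T^*}(w)$.
   Context: Roommate instance $T$: finite agent set; each agent $z$ has a strictly ordered ($>_z$) list of acceptable agents, acceptability symmetric; acceptable pairs are edges. Matchings, blocking edges ($b>_aM(a)$ and $a>_bM(b)$), stable matchings; $T$ is solvable if it has a stable matching. A subtable is a subset of edges with induced orders. $E_S(T)$ is the subtable of edges belonging to some stable matching of $T$. $f_U(z)$ and $\ell_U(z)$ denote the first and last agents in $z$'s list in table $U$. -}

module Defs where

open import Data.Nat using (ℕ)
open import Data.Fin using (Fin)
open import Data.List using (List; _∷_; _++_)
open import Data.List.Membership.Propositional using (_∈_; _∉_)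
open import Data.List.Relation.Unary.Unique.Propositional using (Unique)
open import Data.Product using (Σ; ∃; ∃₂; _×_)
open import Relation.Nullary using (¬_)
open import Relation.Binary.PropositionalEquality using (_≡_; _≢_)

-- A roommate instance on the agent set Fin n: each agent z has a
-- strictly ordered list (pref z) of acceptable agents, earlier = better.
record Table (n : ℕ) : Set where
  field
    pref    : Fin n → List (Fin n)
    nodup   : ∀ z → Unique (pref z)
    noSelf  : ∀ z → z ∉ pref z
    sym     : ∀ z w → w ∈ pref z → z ∈ pref w
open Table public

Before : {A : Set} → List A → A → A → Set
Before l b c = ∃₂ λ xs ys → (l ≡ xs ++ (b ∷ ys)) × (c ∈ ys)

module _ {n : ℕ} (T : Table n) where

  Edge : Fin n → Fin n → Set
  Edge a b = b ∈ pref T a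

  Prefers : Fin n → Fin n → Fin n → Set
  Prefers a b c = Before (pref T a) b c

  -- A (complete) matching: a set of edges covering every agent exactly once,
  -- represented by its partner function.
  record Matching : Set where
    field
      partner   : Fin n → Fin n
      invol     : ∀ a → partner (partner a) ≡ a
      edge      : ∀ a → Edge a (partner a)
  open Matching public

  Blocks : Matching → Fin n → Fin n → Set
  Blocks M a b = Edge a b × Prefers a b (partner M a) × Prefers b a (partner M b)

  Stable : Matching → Set
  Stable M = ∀ a b → ¬ Blocks M a b

  Solvable : Set
  Solvable = Σ Matching Stable

  -- A subtable, given by its (symmetric) edge set; orders are induced from T.
  SubTable : Set₁
  SubTable = Fin n → Fin n → Set

  ES : SubTable
  ES a b = Σ Matching λ M → Stable M × (partner M a ≡ b)

  NonEmptyList : SubTable → Fin n → Set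
  NonEmptyList U z = ∃ λ w → U z w

  IsFirst : SubTable → Fin n → Fin n → Set
  IsFirst U z w = U z w × (∀ u → U z u → u ≢ w → Prefers z w u)

  IsLast : SubTable → Fin n → Fin n → Set
  IsLast U z w = U z w × (∀ u → U z u → u ≢ w → Prefers z u w)

-- Part (a) holds because a stable matching matches every agent. For (b), let
-- M be a stable matching with M(z) = w. If w is z's first choice in T*, then in
-- any stable M' with M'(w) ≠ z the pair {z, w} would block M' unless w prefers
-- M'(w) to z; so z is last on w's list. The converse rests on the
-- opposite-preferences property of two stable matchings M, N: if x prefers
-- M(x) to N(x), then N(x) prefers x to M(N(x)). By stability, "preferring the
-- M-partner to the N-partner" propagates forward along x ↦ N(M(x)); this map
-- is a permutation of a finite set, so every orbit is a cycle and the property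
-- reaches the predecessor of x, which yields the claim.
module Submission where

open import Defs hiding (sym)
open import Data.Nat using (ℕ; zero; suc; _+_)
open import Data.Nat.Properties using (n<1+n; +-suc; m≤n⇒∃[o]m+o≡n)
open import Data.Fin using (Fin; toℕ)
open import Data.Fin.Properties using (pigeonhole)
open import Data.Product using (_×_; _,_; ∃)
open import Data.Sum using (_⊎_; inj₁; inj₂)
open import Data.Empty using (⊥-elim)
open import Data.List using (List; []; _∷_)
open import Data.List.Relation.Unary.Any using (here; there)
open import Data.List.Relation.Unary.All.Properties using (All¬⇒¬Any)
open import Data.List.Relation.Unary.AllPairs using (_∷_)
open import Data.List.Membership.Propositional using (_∈_)
open import Data.List.Relation.Unary.Unique.Propositional using (Unique)
open import Function using (_∘_)
open import Function.Definitions using (Injective)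
import Function.Endo.Propositional as Endo
open import Relation.Nullary using (¬_)
open import Relation.Binary.PropositionalEquality
  using (_≡_; _≢_; refl; sym; trans; cong; cong-app; subst; module ≡-Reasoning)

private variable
  A : Set
  x b c : A
  l : List A

Before-∷ : ∀ x → Before l b c → Before (x ∷ l) b c
Before-∷ x (xs , ys , refl , c∈ys) = x ∷ xs , ys , refl , c∈ys

Before-head : c ∈ l → Before (b ∷ l) b c
Before-head c∈l = [] , _ , refl , c∈l

Before⇒∈ʳ : Before l b c → c ∈ l
Before⇒∈ʳ ([] , ys , refl , c∈ys) = there c∈ys
Before⇒∈ʳ (_ ∷ xs , ys , refl , c∈ys) = there (Before⇒∈ʳ (xs , ys , refl , c∈ys))

Before-∷⁻ : Before (x ∷ l) b c → c ∈ l
Before-∷⁻ ([] , ys , refl , c∈ys) = c∈ys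
Before-∷⁻ (_ ∷ xs , ys , refl , c∈ys) = Before⇒∈ʳ (xs , ys , refl , c∈ys)

Before-uncons : Before (x ∷ l) b c → (x ≡ b × c ∈ l) ⊎ Before l b c
Before-uncons ([] , ys , refl , c∈ys) = inj₁ (refl , c∈ys)
Before-uncons (_ ∷ xs , ys , refl , c∈ys) = inj₂ (xs , ys , refl , c∈ys)

Before-asym : Unique l → Before l b c → ¬ Before l c b
Before-asym (b∉ys ∷ _) ([] , ys , refl , _) q = All¬⇒¬Any b∉ys (Before-∷⁻ q)
Before-asym (x∉l ∷ unique) (_ ∷ xs , ys , refl , c∈ys) q with Before-uncons q
... | inj₁ (refl , _) = All¬⇒¬Any x∉l (Before⇒∈ʳ (xs , ys , refl , c∈ys))
... | inj₂ q′ = Before-asym unique (xs , ys , refl , c∈ys) q′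

Before-total : b ∈ l → c ∈ l → b ≢ c → Before l b c ⊎ Before l c b
Before-total (here refl) (here refl) b≢c = ⊥-elim (b≢c refl)
Before-total (here refl) (there c∈l) _ = inj₁ (Before-head c∈l)
Before-total (there b∈l) (here refl) _ = inj₂ (Before-head b∈l)
Before-total {l = x ∷ _} (there b∈l) (there c∈l) b≢c with Before-total b∈l c∈l b≢c
... | inj₁ p = inj₁ (Before-∷ x p)
... | inj₂ p = inj₂ (Before-∷ x p)

module _ {n : ℕ} {h : Fin n → Fin n} where
  open Endo (Fin n) using (_^_; ^-homo)

  ^-preserves : {P : Fin n → Set} → (∀ {x} → P x → P (h x)) → ∀ d {x} → P x → P ((h ^ d) x)
  ^-preserves step zero px = px
  ^-preserves {P} step (suc d) px = step (^-preserves {P} step d px)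

  module _ (h-injective : Injective _≡_ _≡_ h) where

    ^-injective : ∀ k → Injective _≡_ _≡_ (h ^ k)
    ^-injective zero e = e
    ^-injective (suc k) e = ^-injective k (h-injective e)

    periodic : ∀ a → ∃ λ d → (h ^ suc d) a ≡ a
    periodic a with i , j , i<j , hⁱa≡hʲa ← pigeonhole (n<1+n n) (λ k → (h ^ toℕ k) a)
      with d , 1+i+d≡j ← m≤n⇒∃[o]m+o≡n i<j
      = d , ^-injective (toℕ i) (begin
          (h ^ toℕ i) ((h ^ suc d) a) ≡⟨ cong-app (^-homo h (toℕ i) (suc d)) a ⟨
          (h ^ (toℕ i + suc d)) a     ≡⟨ cong (λ k → (h ^ k) a) (trans (+-suc (toℕ i) d) 1+i+d≡j) ⟩
          (h ^ toℕ j) a               ≡⟨ hⁱa≡hʲa ⟨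
          (h ^ toℕ i) a               ∎)
      where open ≡-Reasoning

    preserves⇒predecessor : {P : Fin n → Set} → (∀ {x} → P x → P (h x)) →
                            ∀ {a} → P a → ∃ λ y → P y × h y ≡ a
    preserves⇒predecessor {P} step {a} pa with d , hᵈ⁺¹a≡a ← periodic a =
      (h ^ d) a , ^-preserves {P} step d pa , hᵈ⁺¹a≡a

module _ {n : ℕ} {T : Table n} where

  Prefers-asym : ∀ {z u v} → Prefers T z u v → ¬ Prefers T z v u
  Prefers-asym {z} = Before-asym (nodup T z)

  Prefers-irrefl : ∀ {z u} → ¬ Prefers T z u u
  Prefers-irrefl p = Prefers-asym p p

  partner-swap : ∀ (M : Matching T) {a b} → partner M a ≡ b → partner M b ≡ a
  partner-swap M {a} refl = invol M a

  partner-injective : ∀ (M : Matching T) → Injective _≡_ _≡_ (partner M)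
  partner-injective M {a} e = trans (sym (invol M a)) (partner-swap M (sym e))

  stable⇒prefers-partner : ∀ {N : Matching T} {x y} → Stable T N → Edge T x y →
                           Prefers T x y (partner N x) → Prefers T y (partner N y) x
  stable⇒prefers-partner {N} {x} {y} N-stable xy y>N[x]
    with Before-total (edge N y) (Table.sym T x y xy) N[y]≢x
    where
    N[y]≢x : partner N y ≢ x
    N[y]≢x e = Prefers-irrefl (subst (Prefers T x y) (partner-swap N e) y>N[x])
  ... | inj₁ N[y]>x = N[y]>x
  ... | inj₂ x>N[y] = ⊥-elim (N-stable x y (xy , y>N[x] , x>N[y]))

  module _ {M N : Matching T} (M-stable : Stable T M) (N-stable : Stable T N) where

    private
      PrefersM : Fin n → Set
      PrefersM x = Prefers T x (partner M x) (partner N x)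

      step : Fin n → Fin n
      step = partner N ∘ partner M

      step-preserves-PrefersM : ∀ {x} → PrefersM x → PrefersM (step x)
      step-preserves-PrefersM {x} M[x]>N[x] =
        subst (Prefers T (step x) (partner M (step x))) (sym (invol N m))
          (stable⇒prefers-partner {N = M} M-stable (edge N m) N[m]>M[m])
        where
        m : Fin n
        m = partner M x
        N[m]>M[m] : Prefers T m (partner N m) (partner M m)
        N[m]>M[m] = subst (Prefers T m (partner N m)) (sym (invol M x))
                      (stable⇒prefers-partner {N = N} N-stable (edge M x) M[x]>N[x])

    stable-opposite : ∀ {x y} → partner N x ≡ y → Prefers T x (partner M x) y →
                      Prefers T y x (partner M y)
    stable-opposite {x} refl M[x]>N[x]
      with w , M[w]>N[w] , refl ← preserves⇒predecessor (partner-injective M ∘ partner-injective N)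
                                    step-preserves-PrefersM {x} M[x]>N[x]
      rewrite invol N (partner M w) | invol M w
      = stable⇒prefers-partner {N = N} N-stable (edge M w) M[w]>N[w]

  ES-sym : ∀ {a b} → ES T a b → ES T b a
  ES-sym (M , M-stable , M[a]≡b) = M , M-stable , partner-swap M M[a]≡b

  ES-first⇒last : ∀ {z w} → IsFirst T (ES T) z w → IsLast T (ES T) w z
  ES-first⇒last {z} (zw@(M , _ , refl) , w-first) = ES-sym zw , others-before-z
    where
    others-before-z : ∀ u → ES T (partner M z) u → u ≢ z → Prefers T (partner M z) u z
    others-before-z _ (M′ , M′-stable , refl) M′[w]≢z =
      stable⇒prefers-partner {N = M′} M′-stable (edge M z)
        (w-first (partner M′ z) (M′ , M′-stable , refl) (M′[w]≢z ∘ partner-swap M′))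

  ES-last⇒first : ∀ {z w} → IsLast T (ES T) w z → IsFirst T (ES T) z w
  ES-last⇒first {w = w} (wz@(M , M-stable , refl) , z-last) = ES-sym wz , w-before-others
    where
    w-before-others : ∀ u → ES T (partner M w) u → u ≢ w → Prefers T (partner M w) w u
    w-before-others _ (M′ , M′-stable , refl) M′[z]≢w
      with Before-total (Table.sym T w (partner M w) (edge M w)) (edge M′ (partner M w))
                        (M′[z]≢w ∘ sym)
    ... | inj₁ w>M′[z] = w>M′[z]
    ... | inj₂ M′[z]>w = ⊥-elim (Prefers-asym
      (z-last (partner M′ w) (M′ , M′-stable , refl) (M′[z]≢w ∘ partner-swap M′))
      (stable-opposite {M = M′} {N = M} M′-stable M-stable (invol M w) M′[z]>w))

lemma10 : {n : ℕ} (T : Table n) → Solvable T →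
            (∀ (z : Fin n) → NonEmptyList T (ES T) z)
            × (∀ (z w : Fin n) →
                 (IsFirst T (ES T) z w → IsLast T (ES T) w z)
                 × (IsLast T (ES T) w z → IsFirst T (ES T) z w))
lemma10 T (M , M-stable) =
  (λ z → partner M z , M , M-stable , refl) , λ _ _ → ES-first⇒last , ES-last⇒first
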